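{- Let $n$ and $t$ be natural numbers with $\gcd(n,2t)=2$. Denote by $\mathrm{wt}(x)$ the binary (Hamming) weight of the least nonnegative residue of $x$ modulo $2^n-1$. Then: 1. $\mathrm{wt}(e(m,2t))=m$ for every $0<m<\frac n2$; 2. $\mathrm{wt}(e(\frac n2+m,2t))=\frac n2$ for every $0<m<\frac n2$; 3. $\mathrm{wt}(e(n+m,2t))=\frac n2+m$ for every $0<m<\frac n2$; 4. $e(\frac{3n}{2}+m,2t)\equiv e(m,2t)\pmod{2^n-1}$ for every $0<m<\frac n2$.
   Context: For natural numbers $l,k$, $e(l,k)=\sum_{j=0}^{l-1}2^{jk}$. The binary weight of a nonnegative integer is the number of ones in its binary expansion. -}

module Defs where

open import Data.Nat using (ℕ; zero; suc; _+_; _*_; _^_; _∸_; _%_; _/_)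
open import Data.List using (List; upTo; map)
open import Data.Nat.ListAction using (sum)

e : ℕ → ℕ → ℕ
e l k = sum (map (λ j → 2 ^ (j * k)) (upTo l))

-- binary weight (number of ones in the binary expansion), by well-founded
-- recursion on x via a fuel argument (x halves at each step, fuel x suffices)
weightFuel : ℕ → ℕ → ℕ
weightFuel zero    x = 0
weightFuel (suc f) x = x % 2 + weightFuel f (x / 2)

binWeight : ℕ → ℕ
binWeight x = weightFuel x x

-- least nonnegative residue of x modulo M (M = 0: x itself, the usual
-- convention; this case never occurs non-vacuously in the statement)
residue : ℕ → ℕ → ℕ
residue zero    x = x
residue (suc k) x = x % suc k

wt : ℕ → ℕ → ℕ
wt n x = binWeight (residue (2 ^ n ∸ 1) x)

-- Write n = 2h; then t is coprime to h, and modulo N = 4^h − 1 we have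
-- 2^(2tj) ≡ 4^(jt mod h). Hence e(L, 2t) is congruent to the base-4 number
-- whose i-th digit counts the j < L with jt ≡ i (mod h). Since j ↦ jt mod h
-- permutes the residues mod h, every block of h consecutive j raises every
-- digit by one: for L = ch + m with m < h the digits are c or c + 1, exactly
-- m of them being c + 1. For c ≤ 2 not all digits are 3, so this number is
-- the least residue itself and its binary weight is the sum of the weights of
-- its digits; for c = 3 the extra block of 3s is N ≡ 0.
module Submission where

open import Defs
open import Data.Nat
  using (ℕ; zero; suc; _+_; _*_; _^_; _∸_; _<_; _≤_; _/_; _%_; _≟_; z≤n; s≤s; z<s; s<s;
         NonZero; >-nonZero; >-nonZero⁻¹)
open import Data.Nat.Properties
open import Data.Nat.DivMod
open import Data.Nat.Divisibility using (_∣_; divides; ∣⇒≤; ∣-refl)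
open import Data.Nat.GCD using (gcd; c*gcd[m,n]≡gcd[cm,cn]; gcd[m,n]∣m)
open import Data.Nat.Coprimality using (Coprime; coprime-divisor; gcd≡1⇒coprime)
open import Data.Nat.ListAction using (sum)
open import Data.Nat.ListAction.Properties using (sum-++)
open import Data.Nat.Tactic.RingSolver using (solve-∀)
open import Data.List using (map; upTo; _++_; [_])
open import Data.List.Properties using (upTo-∷ʳ; map-++)
open import Data.Product using (_×_; _,_)
open import Data.Empty using (⊥-elim)
open import Function using (_∘_; const)
open import Relation.Nullary using (yes; no)
open import Relation.Binary.PropositionalEquality
  using (_≡_; _≢_; refl; sym; trans; cong; cong₂; subst; module ≡-Reasoning)

weightFuel-zero : ∀ f → weightFuel f 0 ≡ 0
weightFuel-zero zero    = refl
weightFuel-zero (suc f) = weightFuel-zero f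

binWeight-bit : ∀ {x} → x ≤ 1 → binWeight x ≡ x
binWeight-bit z≤n       = refl
binWeight-bit (s≤s z≤n) = refl

binWeight-1+bit : ∀ {x} → x ≤ 1 → binWeight (1 + x) ≡ 1
binWeight-1+bit z≤n       = refl
binWeight-1+bit (s≤s z≤n) = refl

binWeight-2+bit : ∀ {x} → x ≤ 1 → binWeight (2 + x) ≡ 1 + x
binWeight-2+bit z≤n       = refl
binWeight-2+bit (s≤s z≤n) = refl

half-≤ : ∀ {x f} → x ≤ suc f → x / 2 ≤ f
half-≤ {zero}  _         = z≤n
half-≤ {suc x} (s≤s x≤f) = ≤-trans (≤-pred (m/n<m (suc x) 2 (s≤s (s≤s z≤n)))) x≤f

weightFuel-stable : ∀ f g x → x ≤ f → x ≤ g → weightFuel f x ≡ weightFuel g x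
weightFuel-stable zero    zero    x  _ _   = refl
weightFuel-stable zero    (suc g) .0 z≤n _ = sym (weightFuel-zero (suc g))
weightFuel-stable (suc f) zero    .0 _ z≤n = weightFuel-zero (suc f)
weightFuel-stable (suc f) (suc g) x  x≤f x≤g =
  cong (x % 2 +_) (weightFuel-stable f g (x / 2) (half-≤ x≤f) (half-≤ x≤g))

weightFuel-bit : ∀ f {b} v → b < 2 → weightFuel (suc f) (b + v * 2) ≡ b + weightFuel f v
weightFuel-bit f {b} v b<2 = cong₂ (λ x y → x + weightFuel f y) low high
  where
  low : (b + v * 2) % 2 ≡ b
  low = trans ([m+kn]%n≡m%n b v 2) (m<n⇒m%n≡m b<2)
  high : (b + v * 2) / 2 ≡ v
  high = trans (+-distrib-/-∣ʳ b (divides v refl)) (cong₂ _+_ (m<n⇒m/n≡0 b<2) (m*n/n≡m v 2))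

weightFuel-bits : ∀ f {b₀ b₁} v → b₀ < 2 → b₁ < 2 →
                  weightFuel (2 + f) (b₀ + b₁ * 2 + 4 * v) ≡ b₀ + (b₁ + weightFuel f v)
weightFuel-bits f {b₀} {b₁} v p q = begin
  weightFuel (2 + f) (b₀ + b₁ * 2 + 4 * v)   ≡⟨ cong (weightFuel (2 + f)) (regroup b₀ b₁ v) ⟩
  weightFuel (2 + f) (b₀ + (b₁ + v * 2) * 2) ≡⟨ weightFuel-bit (suc f) (b₁ + v * 2) p ⟩
  b₀ + weightFuel (suc f) (b₁ + v * 2)       ≡⟨ cong (b₀ +_) (weightFuel-bit f v q) ⟩
  b₀ + (b₁ + weightFuel f v)                 ∎
  where
  open ≡-Reasoning
  regroup : ∀ b₀ b₁ v → b₀ + b₁ * 2 + 4 * v ≡ b₀ + (b₁ + v * 2) * 2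
  regroup = solve-∀

weightFuel-digit : ∀ f {x} v → x ≤ 3 → weightFuel (2 + f) (x + 4 * v) ≡ binWeight x + weightFuel f v
weightFuel-digit f v z≤n                     = weightFuel-bits f {0} {0} v z<s z<s
weightFuel-digit f v (s≤s z≤n)               = weightFuel-bits f {1} {0} v (s<s z<s) z<s
weightFuel-digit f v (s≤s (s≤s z≤n))         = weightFuel-bits f {0} {1} v z<s (s<s z<s)
weightFuel-digit f v (s≤s (s≤s (s≤s z≤n))) = weightFuel-bits f {1} {1} v (s<s z<s) (s<s z<s)

base4 : (ℕ → ℕ) → ℕ → ℕ
base4 d zero    = 0
base4 d (suc k) = d 0 + 4 * base4 (d ∘ suc) k

digitSum : (ℕ → ℕ) → ℕ → ℕ
digitSum d zero    = 0
digitSum d (suc k) = d 0 + digitSum (d ∘ suc) k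

Digits≤ : ℕ → ℕ → (ℕ → ℕ) → Set
Digits≤ c k d = ∀ {i} → i < k → d i ≤ c

weightFuel-base4 : ∀ k {d} f → Digits≤ 3 k d →
                   weightFuel (k * 2 + f) (base4 d k) ≡ digitSum (binWeight ∘ d) k
weightFuel-base4 zero    f _  = weightFuel-zero f
weightFuel-base4 (suc k) {d} f ds =
  trans (weightFuel-digit (k * 2 + f) (base4 (d ∘ suc) k) (ds z<s))
        (cong (binWeight (d 0) +_) (weightFuel-base4 k f (ds ∘ s<s)))

binWeight-base4 : ∀ k {d} → Digits≤ 3 k d → binWeight (base4 d k) ≡ digitSum (binWeight ∘ d) k
binWeight-base4 k {d} ds =
  trans (weightFuel-stable x (k * 2 + x) x ≤-refl (m≤n+m x (k * 2))) (weightFuel-base4 k x ds)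
  where x = base4 d k

base4-cong : ∀ k {a b} → (∀ {i} → i < k → a i ≡ b i) → base4 a k ≡ base4 b k
base4-cong zero    _  = refl
base4-cong (suc k) eq = cong₂ (λ x y → x + 4 * y) (eq z<s) (base4-cong k (eq ∘ s<s))

digitSum-cong : ∀ k {a b} → (∀ {i} → i < k → a i ≡ b i) → digitSum a k ≡ digitSum b k
digitSum-cong zero    _  = refl
digitSum-cong (suc k) eq = cong₂ _+_ (eq z<s) (digitSum-cong k (eq ∘ s<s))

base4-+ : ∀ k {a b} → base4 (λ i → a i + b i) k ≡ base4 a k + base4 b k
base4-+ zero            = refl
base4-+ (suc k) {a} {b} =
  trans (cong (λ y → a 0 + b 0 + 4 * y) (base4-+ k))
        (interchange (a 0) (b 0) (base4 (a ∘ suc) k) (base4 (b ∘ suc) k))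
  where
  interchange : ∀ x y u v → x + y + 4 * (u + v) ≡ x + 4 * u + (y + 4 * v)
  interchange = solve-∀

digitSum-+ : ∀ k {a b} → digitSum (λ i → a i + b i) k ≡ digitSum a k + digitSum b k
digitSum-+ zero            = refl
digitSum-+ (suc k) {a} {b} =
  trans (cong (a 0 + b 0 +_) (digitSum-+ k))
        (+-assoc-comm (a 0) (b 0) (digitSum (a ∘ suc) k) (digitSum (b ∘ suc) k))
  where
  +-assoc-comm : ∀ x y u v → x + y + (u + v) ≡ x + u + (y + v)
  +-assoc-comm = solve-∀

base4-zero : ∀ k → base4 (const 0) k ≡ 0
base4-zero zero    = refl
base4-zero (suc k) = cong (4 *_) (base4-zero k)

base4-three : ∀ k → suc (base4 (const 3) k) ≡ 4 ^ k
base4-three zero    = refl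
base4-three (suc k) = trans (carry (base4 (const 3) k)) (cong (4 *_) (base4-three k))
  where
  carry : ∀ x → suc (3 + 4 * x) ≡ 4 * suc x
  carry = solve-∀

digitSum-const : ∀ c k → digitSum (const c) k ≡ c * k
digitSum-const c zero    = sym (*-zeroʳ c)
digitSum-const c (suc k) = trans (cong (c +_) (digitSum-const c k)) (sym (*-suc c k))

digitSum≤base4 : ∀ k {d} → digitSum d k ≤ base4 d k
digitSum≤base4 zero            = z≤n
digitSum≤base4 (suc k) {d} =
  +-monoʳ-≤ (d 0) (≤-trans (digitSum≤base4 k) (m≤n*m (base4 (d ∘ suc) k) 4))

digitSum≡0 : ∀ k {d i} → digitSum d k ≡ 0 → i < k → d i ≡ 0
digitSum≡0 (suc k) {d} {zero}  s≡0 _       = m+n≡0⇒m≡0 (d 0) s≡0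
digitSum≡0 (suc k) {d} {suc i} s≡0 (s<s p) = digitSum≡0 k (m+n≡0⇒n≡0 (d 0) s≡0) p

digitSum-complement : ∀ c k {d} → Digits≤ c k d →
                      digitSum d k + digitSum (λ i → c ∸ d i) k ≡ c * k
digitSum-complement c k ds =
  trans (sym (digitSum-+ k)) (trans (digitSum-cong k (m+[n∸m]≡n ∘ ds)) (digitSum-const c k))

digitSum-ones : ∀ k {d i} → Digits≤ 1 k d → digitSum d k ≡ k → i < k → d i ≡ 1
digitSum-ones k {d} ds sum≡k p = ≤-antisym (ds p) (m∸n≡0⇒m≤n (digitSum≡0 k gaps≡0 p))
  where
  gaps≡0 : digitSum (λ i → 1 ∸ d i) k ≡ 0
  gaps≡0 = +-cancelˡ-≡ k _ 0 (begin
    k + digitSum (λ i → 1 ∸ d i) k            ≡⟨ cong (_+ digitSum (λ i → 1 ∸ d i) k) sum≡k ⟨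
    digitSum d k + digitSum (λ i → 1 ∸ d i) k ≡⟨ digitSum-complement 1 k ds ⟩
    1 * k                                     ≡⟨ *-identityˡ k ⟩
    k                                         ≡⟨ +-identityʳ k ⟨
    k + 0                                     ∎)
    where open ≡-Reasoning

positive-summand : ∀ {m n o} → m + n ≡ o → m < o → 0 < n
positive-summand {m} {zero}  refl m<m+0 = ⊥-elim (<-irrefl (sym (+-identityʳ m)) m<m+0)
positive-summand {m} {suc n} _    _     = z<s

-- The complementary digits 3 ∸ d i have positive sum, hence positive value.
base4<base4-three : ∀ k {d} → Digits≤ 3 k d → digitSum d k < 3 * k → base4 d k < base4 (const 3) k
base4<base4-three k {d} ds small =
  subst (base4 d k <_) values (m<m+n (base4 d k) (≤-trans gap>0 (digitSum≤base4 k)))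
  where
  gap = λ i → 3 ∸ d i
  gap>0 : 0 < digitSum gap k
  gap>0 = positive-summand (digitSum-complement 3 k ds) small
  values : base4 d k + base4 gap k ≡ base4 (const 3) k
  values = trans (sym (base4-+ k)) (base4-cong k (m+[n∸m]≡n ∘ ds))

δ : ℕ → ℕ → ℕ
δ zero    zero    = 1
δ zero    (suc _) = 0
δ (suc _) zero    = 0
δ (suc r) (suc i) = δ r i

δ-diag : ∀ r → δ r r ≡ 1
δ-diag zero    = refl
δ-diag (suc r) = δ-diag r

δ-off : ∀ {r i} → r ≢ i → δ r i ≡ 0
δ-off {zero}  {zero}  r≢i = ⊥-elim (r≢i refl)
δ-off {zero}  {suc i} _   = refl
δ-off {suc r} {zero}  _   = refl
δ-off {suc r} {suc i} r≢i = δ-off (r≢i ∘ cong suc)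

base4-δ : ∀ k {r} → r < k → base4 (δ r) k ≡ 4 ^ r
base4-δ (suc k) {zero}  _       = cong (λ x → 1 + 4 * x) (base4-zero k)
base4-δ (suc k) {suc r} (s<s p) = cong (4 *_) (base4-δ k p)

digitSum-δ : ∀ k {r} → r < k → digitSum (δ r) k ≡ 1
digitSum-δ (suc k) {zero}  _       = cong suc (digitSum-const 0 k)
digitSum-δ (suc k) {suc r} (s<s p) = digitSum-δ k p

%-≡⇒∣∸ : ∀ {a b} n .{{_ : NonZero n}} → a % n ≡ b % n → n ∣ a ∸ b
%-≡⇒∣∸ {a} {b} n eq = divides (a / n ∸ b / n) (begin
  a ∸ b                                      ≡⟨ cong₂ _∸_ (m≡m%n+[m/n]*n a n) (m≡m%n+[m/n]*n b n) ⟩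
  (a % n + a / n * n) ∸ (b % n + b / n * n) ≡⟨ cong (λ r → (a % n + a / n * n) ∸ (r + b / n * n)) eq ⟨
  (a % n + a / n * n) ∸ (a % n + b / n * n) ≡⟨ [m+n]∸[m+o]≡n∸o (a % n) (a / n * n) (b / n * n) ⟩
  a / n * n ∸ b / n * n                      ≡⟨ *-distribʳ-∸ n (a / n) (b / n) ⟨
  (a / n ∸ b / n) * n                        ∎)
  where open ≡-Reasoning

%-+-cong : ∀ {a b c d} n .{{_ : NonZero n}} →
           a % n ≡ b % n → c % n ≡ d % n → (a + c) % n ≡ (b + d) % n
%-+-cong {a} {b} {c} {d} n p q =
  trans (%-distribˡ-+ a c n) (trans (cong₂ (λ x y → (x + y) % n) p q) (sym (%-distribˡ-+ b d n)))

%-*-≡1 : ∀ a {b} n .{{_ : NonZero n}} → b % n ≡ 1 % n → (a * b) % n ≡ a % n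
%-*-≡1 a {b} n b≡1 = begin
  (a * b) % n             ≡⟨ %-distribˡ-* a b n ⟩
  ((a % n) * (b % n)) % n ≡⟨ cong (λ y → ((a % n) * y) % n) b≡1 ⟩
  ((a % n) * (1 % n)) % n ≡⟨ %-distribˡ-* a 1 n ⟨
  (a * 1) % n             ≡⟨ cong (_% n) (*-identityʳ a) ⟩
  a % n                   ∎
  where open ≡-Reasoning

%-^-≡1 : ∀ {b} n .{{_ : NonZero n}} → b % n ≡ 1 % n → ∀ q → b ^ q % n ≡ 1 % n
%-^-≡1 n b≡1 zero    = refl
%-^-≡1 n b≡1 (suc q) = trans (%-*-≡1 _ n (%-^-≡1 n b≡1 q)) b≡1

^-%-period : ∀ {a h} n .{{_ : NonZero h}} .{{_ : NonZero n}} →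
             a ^ h % n ≡ 1 % n → ∀ k → a ^ k % n ≡ a ^ (k % h) % n
^-%-period {a} {h} n aʰ≡1 k = begin
  a ^ k % n                           ≡⟨ cong (λ j → a ^ j % n) (m≡m%n+[m/n]*n k h) ⟩
  a ^ (k % h + k / h * h) % n         ≡⟨ cong (_% n) (^-distribˡ-+-* a (k % h) (k / h * h)) ⟩
  a ^ (k % h) * a ^ (k / h * h) % n   ≡⟨ cong (λ j → a ^ (k % h) * a ^ j % n) (*-comm (k / h) h) ⟩
  a ^ (k % h) * a ^ (h * (k / h)) % n ≡⟨ cong (λ y → a ^ (k % h) * y % n) (^-*-assoc a h (k / h)) ⟨
  a ^ (k % h) * (a ^ h) ^ (k / h) % n ≡⟨ %-*-≡1 (a ^ (k % h)) n (%-^-≡1 n aʰ≡1 (k / h)) ⟩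
  a ^ (k % h) % n                     ∎
  where open ≡-Reasoning

e-suc : ∀ L k → e (suc L) k ≡ e L k + 2 ^ (L * k)
e-suc L k = begin
  sum (map f (upTo (suc L)))      ≡⟨ cong (sum ∘ map f) (upTo-∷ʳ L) ⟨
  sum (map f (upTo L ++ [ L ]))   ≡⟨ cong sum (map-++ f (upTo L) [ L ]) ⟩
  sum (map f (upTo L) ++ [ f L ]) ≡⟨ sum-++ (map f (upTo L)) [ f L ] ⟩
  e L k + (f L + 0)               ≡⟨ cong (e L k +_) (+-identityʳ (f L)) ⟩
  e L k + 2 ^ (L * k)             ∎
  where
  open ≡-Reasoning
  f = λ j → 2 ^ (j * k)

residue-nonZero : ∀ M .{{_ : NonZero M}} x → residue M x ≡ x % M
residue-nonZero (suc _) x = refl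

gcd[m*2,2*n]≡2⇒coprime : ∀ {m n} → gcd (m * 2) (2 * n) ≡ 2 → Coprime m n
gcd[m*2,2*n]≡2⇒coprime {m} {n} gcd≡2 = gcd≡1⇒coprime (*-cancelˡ-≡ (gcd m n) 1 2 (begin
  2 * gcd m n           ≡⟨ c*gcd[m,n]≡gcd[cm,cn] 2 m n ⟩
  gcd (2 * m) (2 * n)   ≡⟨ cong (λ x → gcd x (2 * n)) (*-comm 2 m) ⟩
  gcd (m * 2) (2 * n)   ≡⟨ gcd≡2 ⟩
  2                     ∎))
  where open ≡-Reasoning

module CoprimeMultiples (h t : ℕ) .{{_ : NonZero h}} (h⊥t : Coprime h t) where

  pos : ℕ → ℕ
  pos j = j * t % h

  hits : ℕ → ℕ → ℕ
  hits zero    i = 0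
  hits (suc L) i = hits L i + δ (pos L) i

  digitSum-hits : ∀ L → digitSum (hits L) h ≡ L
  digitSum-hits zero    = digitSum-const 0 h
  digitSum-hits (suc L) = begin
    digitSum (hits (suc L)) h                      ≡⟨ digitSum-+ h ⟩
    digitSum (hits L) h + digitSum (δ (pos L)) h   ≡⟨ cong₂ _+_ (digitSum-hits L) (digitSum-δ h (m%n<n (L * t) h)) ⟩
    L + 1                                          ≡⟨ +-comm L 1 ⟩
    suc L                                          ∎
    where open ≡-Reasoning

  pos-+h : ∀ L → pos (h + L) ≡ pos L
  pos-+h L = trans (cong (_% h) (expand h L t)) ([m+kn]%n≡m%n (L * t) t h)
    where
    expand : ∀ h L t → (h + L) * t ≡ L * t + t * h
    expand = solve-∀

  hits-+h : ∀ L i → hits (h + L) i ≡ hits h i + hits L i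
  hits-+h zero    i = trans (cong (λ L → hits L i) (+-identityʳ h)) (sym (+-identityʳ _))
  hits-+h (suc L) i = begin
    hits (h + suc L) i                    ≡⟨ cong (λ L → hits L i) (+-suc h L) ⟩
    hits (h + L) i + δ (pos (h + L)) i    ≡⟨ cong₂ _+_ (hits-+h L i) (cong (λ r → δ r i) (pos-+h L)) ⟩
    hits h i + hits L i + δ (pos L) i     ≡⟨ +-assoc (hits h i) _ _ ⟩
    hits h i + hits (suc L) i             ∎
    where open ≡-Reasoning

  pos-injective : ∀ {j L} → j < L → L < h → pos j ≢ pos L
  pos-injective {j} {L} j<L L<h eq = <⇒≱ (≤-<-trans (m∸n≤m L j) L<h) h≤L∸j
    where
    h∣t*[L∸j] : h ∣ t * (L ∸ j)
    h∣t*[L∸j] = subst (h ∣_) (trans (sym (*-distribʳ-∸ t L j)) (*-comm (L ∸ j) t))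
                  (%-≡⇒∣∸ h (sym eq))
    h≤L∸j : h ≤ L ∸ j
    h≤L∸j = ∣⇒≤ {{>-nonZero (m<n⇒0<n∸m j<L)}} (coprime-divisor h⊥t h∣t*[L∸j])

  hits-fresh : ∀ L {i} → (∀ {j} → j < L → pos j ≢ i) → hits L i ≡ 0
  hits-fresh zero    _     = refl
  hits-fresh (suc L) fresh =
    cong₂ _+_ (hits-fresh L (fresh ∘ m<n⇒m<1+n)) (δ-off (fresh (n<1+n L)))

  hits≤1 : ∀ {L} → L ≤ h → ∀ i → hits L i ≤ 1
  hits≤1 {zero}  _   i = z≤n
  hits≤1 {suc L} L<h i with pos L ≟ i
  ... | yes refl rewrite hits-fresh L (λ j<L → pos-injective j<L L<h) | δ-diag (pos L) = ≤-refl
  ... | no  L↛i  rewrite δ-off L↛i | +-identityʳ (hits L i) = hits≤1 (<⇒≤ L<h) i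

  -- Pigeonhole: h hits in total on h residues, each hit at most once.
  hits-full : ∀ {i} → i < h → hits h i ≡ 1
  hits-full = digitSum-ones h (λ {i} _ → hits≤1 ≤-refl i) (digitSum-hits h)

  hits-periodic : ∀ c L {i} → i < h → hits (c * h + L) i ≡ c + hits L i
  hits-periodic zero    L i<h = refl
  hits-periodic (suc c) L {i} i<h = begin
    hits (h + c * h + L) i           ≡⟨ cong (λ L → hits L i) (+-assoc h (c * h) L) ⟩
    hits (h + (c * h + L)) i         ≡⟨ hits-+h (c * h + L) i ⟩
    hits h i + hits (c * h + L) i    ≡⟨ cong₂ _+_ (hits-full i<h) (hits-periodic c L i<h) ⟩
    suc c + hits L i                 ∎
    where open ≡-Reasoning

  N : ℕ
  N = 4 ^ h ∸ 1

  4^h≡1+N : 4 ^ h ≡ suc N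
  4^h≡1+N = sym (suc-pred (4 ^ h) {{m^n≢0 4 h}})

  instance
    N-nonZero : NonZero N
    N-nonZero = >-nonZero (m<n⇒0<n∸m (^-monoʳ-< 4 (s<s z<s) (>-nonZero⁻¹ h)))

  base4-three≡N : base4 (const 3) h ≡ N
  base4-three≡N = suc-injective (trans (base4-three h) 4^h≡1+N)

  4^pos : ∀ L → 2 ^ (L * (2 * t)) % N ≡ 4 ^ pos L % N
  4^pos L = begin
    2 ^ (L * (2 * t)) % N ≡⟨ cong (λ j → 2 ^ j % N) (reassoc L t) ⟩
    2 ^ (2 * (L * t)) % N ≡⟨ cong (_% N) (^-*-assoc 2 2 (L * t)) ⟨
    4 ^ (L * t) % N       ≡⟨ ^-%-period N 4^h≡1 (L * t) ⟩
    4 ^ pos L % N         ∎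
    where
    open ≡-Reasoning
    reassoc : ∀ L t → L * (2 * t) ≡ 2 * (L * t)
    reassoc = solve-∀
    4^h≡1 : 4 ^ h % N ≡ 1 % N
    4^h≡1 = trans (cong (_% N) 4^h≡1+N) ([m+n]%n≡m%n 1 N)

  e≡base4-hits : ∀ L → e L (2 * t) % N ≡ base4 (hits L) h % N
  e≡base4-hits zero    = cong (_% N) (sym (base4-zero h))
  e≡base4-hits (suc L) = begin
    e (suc L) (2 * t) % N                           ≡⟨ cong (_% N) (e-suc L (2 * t)) ⟩
    (e L (2 * t) + 2 ^ (L * (2 * t))) % N           ≡⟨ %-+-cong N (e≡base4-hits L) (trans (4^pos L) unit) ⟩
    (base4 (hits L) h + base4 (δ (pos L)) h) % N    ≡⟨ cong (_% N) (base4-+ h) ⟨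
    base4 (hits (suc L)) h % N                      ∎
    where
    open ≡-Reasoning
    unit : 4 ^ pos L % N ≡ base4 (δ (pos L)) h % N
    unit = cong (_% N) (sym (base4-δ h (m%n<n (L * t) h)))

  digitSum-+hits : ∀ c m → digitSum (λ i → c + hits m i) h ≡ c * h + m
  digitSum-+hits c m = trans (digitSum-+ h) (cong₂ _+_ (digitSum-const c h) (digitSum-hits m))

  digitSum-+hits<3h : ∀ {c m} → c ≤ 2 → m < h → digitSum (λ i → c + hits m i) h < 3 * h
  digitSum-+hits<3h {c} {m} c≤2 m<h = begin-strict
    digitSum (λ i → c + hits m i) h ≡⟨ digitSum-+hits c m ⟩
    c * h + m                       <⟨ +-monoʳ-< (c * h) m<h ⟩
    c * h + h                       ≡⟨ +-comm (c * h) h ⟩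
    suc c * h                       ≤⟨ *-monoˡ-≤ h (s≤s c≤2) ⟩
    3 * h                           ∎
    where open ≤-Reasoning

  residue≡%N : ∀ x → residue (2 ^ (h * 2) ∸ 1) x ≡ x % N
  residue≡%N x = trans (cong (λ M → residue (M ∸ 1) x) 2^[h*2]≡4^h) (residue-nonZero N x)
    where
    2^[h*2]≡4^h : 2 ^ (h * 2) ≡ 4 ^ h
    2^[h*2]≡4^h = trans (cong (2 ^_) (*-comm h 2)) (sym (^-*-assoc 2 2 h))

  wt-e : ∀ c {m} → c ≤ 2 → m < h →
         wt (h * 2) (e (c * h + m) (2 * t)) ≡ digitSum (λ i → binWeight (c + hits m i)) h
  wt-e c {m} c≤2 m<h = begin
    wt (h * 2) (e (c * h + m) (2 * t))         ≡⟨ cong binWeight (residue≡%N (e (c * h + m) (2 * t))) ⟩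
    binWeight (e (c * h + m) (2 * t) % N)      ≡⟨ cong binWeight (e≡base4-hits (c * h + m)) ⟩
    binWeight (base4 (hits (c * h + m)) h % N) ≡⟨ cong (λ x → binWeight (x % N)) (base4-cong h (hits-periodic c m)) ⟩
    binWeight (base4 d h % N)                  ≡⟨ cong binWeight (m<n⇒m%n≡m reduced) ⟩
    binWeight (base4 d h)                      ≡⟨ binWeight-base4 h ds ⟩
    digitSum (binWeight ∘ d) h                 ∎
    where
    open ≡-Reasoning
    d = λ i → c + hits m i
    ds : Digits≤ 3 h d
    ds {i} _ = +-mono-≤ c≤2 (hits≤1 (<⇒≤ m<h) i)
    reduced : base4 d h < N
    reduced = subst (base4 d h <_) base4-three≡N (base4<base4-three h ds (digitSum-+hits<3h c≤2 m<h))

  wt-e[m] : ∀ {m} → m < h → wt (h * 2) (e m (2 * t)) ≡ m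
  wt-e[m] {m} m<h = begin
    wt (h * 2) (e m (2 * t))                 ≡⟨ wt-e 0 z≤n m<h ⟩
    digitSum (λ i → binWeight (hits m i)) h  ≡⟨ digitSum-cong h (λ {i} _ → binWeight-bit (bit i)) ⟩
    digitSum (hits m) h                      ≡⟨ digitSum-hits m ⟩
    m                                        ∎
    where
    open ≡-Reasoning
    bit = hits≤1 (<⇒≤ m<h)

  wt-e[h+m] : ∀ {m} → m < h → wt (h * 2) (e (h + m) (2 * t)) ≡ h
  wt-e[h+m] {m} m<h = begin
    wt (h * 2) (e (h + m) (2 * t))               ≡⟨ cong (λ c → wt (h * 2) (e (c + m) (2 * t))) (*-identityˡ h) ⟨
    wt (h * 2) (e (1 * h + m) (2 * t))           ≡⟨ wt-e 1 (s≤s z≤n) m<h ⟩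
    digitSum (λ i → binWeight (1 + hits m i)) h  ≡⟨ digitSum-cong h (λ {i} _ → binWeight-1+bit (bit i)) ⟩
    digitSum (const 1) h                         ≡⟨ digitSum-const 1 h ⟩
    1 * h                                        ≡⟨ *-identityˡ h ⟩
    h                                            ∎
    where
    open ≡-Reasoning
    bit = hits≤1 (<⇒≤ m<h)

  wt-e[2h+m] : ∀ {m} → m < h → wt (h * 2) (e (h * 2 + m) (2 * t)) ≡ h + m
  wt-e[2h+m] {m} m<h = begin
    wt (h * 2) (e (h * 2 + m) (2 * t))           ≡⟨ cong (λ c → wt (h * 2) (e (c + m) (2 * t))) (*-comm h 2) ⟩
    wt (h * 2) (e (2 * h + m) (2 * t))           ≡⟨ wt-e 2 ≤-refl m<h ⟩
    digitSum (λ i → binWeight (2 + hits m i)) h  ≡⟨ digitSum-cong h (λ {i} _ → binWeight-2+bit (bit i)) ⟩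
    digitSum (λ i → 1 + hits m i) h              ≡⟨ digitSum-+hits 1 m ⟩
    1 * h + m                                    ≡⟨ cong (_+ m) (*-identityˡ h) ⟩
    h + m                                        ∎
    where
    open ≡-Reasoning
    bit = hits≤1 (<⇒≤ m<h)

  e[3h+m]≡e[m] : ∀ m → residue (2 ^ (h * 2) ∸ 1) (e (3 * h + m) (2 * t))
                     ≡ residue (2 ^ (h * 2) ∸ 1) (e m (2 * t))
  e[3h+m]≡e[m] m = begin
    residue (2 ^ (h * 2) ∸ 1) (e (3 * h + m) (2 * t)) ≡⟨ residue≡%N _ ⟩
    e (3 * h + m) (2 * t) % N                         ≡⟨ e≡base4-hits (3 * h + m) ⟩
    base4 (hits (3 * h + m)) h % N                    ≡⟨ cong (_% N) (base4-cong h (hits-periodic 3 m)) ⟩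
    base4 (λ i → 3 + hits m i) h % N                  ≡⟨ cong (_% N) (base4-+ h) ⟩
    (base4 (const 3) h + base4 (hits m) h) % N        ≡⟨ cong (λ x → (x + base4 (hits m) h) % N) base4-three≡N ⟩
    (N + base4 (hits m) h) % N                        ≡⟨ %-remove-+ˡ (base4 (hits m) h) (∣-refl {N}) ⟩
    base4 (hits m) h % N                              ≡⟨ e≡base4-hits m ⟨
    e m (2 * t) % N                                   ≡⟨ residue≡%N _ ⟨
    residue (2 ^ (h * 2) ∸ 1) (e m (2 * t))           ∎
    where open ≡-Reasoning

m*2/2≡m : ∀ m → m * 2 / 2 ≡ m
m*2/2≡m m = m*n/n≡m m 2

3*[m*2]/2≡3*m : ∀ m → 3 * (m * 2) / 2 ≡ 3 * m
3*[m*2]/2≡3*m m = trans (cong (_/ 2) (sym (*-assoc 3 m 2))) (m*n/n≡m (3 * m) 2)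

lemma3 : (n t : ℕ) → gcd n (2 * t) ≡ 2 →
    ((m : ℕ) → 0 < m → m < n / 2 → wt n (e m (2 * t)) ≡ m)
    × ((m : ℕ) → 0 < m → m < n / 2 → wt n (e (n / 2 + m) (2 * t)) ≡ n / 2)
    × ((m : ℕ) → 0 < m → m < n / 2 → wt n (e (n + m) (2 * t)) ≡ n / 2 + m)
    × ((m : ℕ) → 0 < m → m < n / 2 →
    residue (2 ^ n ∸ 1) (e ((3 * n) / 2 + m) (2 * t))
    ≡ residue (2 ^ n ∸ 1) (e m (2 * t)))
lemma3 n t gcd≡2 with subst (_∣ n) gcd≡2 (gcd[m,n]∣m n (2 * t))
... | divides zero refl = (λ _ _ ()) , (λ _ _ ()) , (λ _ _ ()) , (λ _ _ ())
... | divides h@(suc _) refl rewrite m*2/2≡m h | 3*[m*2]/2≡3*m h =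
  (λ _ _ → wt-e[m]) , (λ _ _ → wt-e[h+m]) , (λ _ _ → wt-e[2h+m]) , (λ m _ _ → e[3h+m]≡e[m] m)
  where open CoprimeMultiples h t (gcd[m*2,2*n]≡2⇒coprime gcd≡2)
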